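{- Let $G$ and $H$ be two connected graphs of orders $n\geqslant 3$ and $m\geqslant 3$, respectively. If $D'(G)=D'(H)=1$, then $D'(G\circ H)=1$.
   Context: The corona $G\circ H$ is obtained by taking one copy of $G$ and $|V(G)|$ copies of $H$ and joining the $i$-th vertex of $G$ to every vertex of the $i$-th copy of $H$. The distinguishing index $D'(G)$ is the least $d$ such that some edge colouring $E(G)\to\{1,\dots,d\}$ (not necessarily proper) is preserved by no non-identity automorphism of $G$ (acting on edges). -}

module Defs where

open import Data.Nat using (ℕ; _<_)
open import Data.Fin using (Fin; _≟_)
open import Data.Bool using (Bool; true; false; _∧_)
open import Data.Bool.Properties using (∧-comm)
open import Data.Sum using (_⊎_; inj₁; inj₂)
open import Data.Product using (_×_; _,_; ∃)
open import Relation.Nullary using (¬_; yes; no)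
open import Relation.Nullary.Decidable using (⌊_⌋)
open import Relation.Binary.PropositionalEquality
import Data.Empty

record Graph (V : Set) : Set where
  field
    adj    : V → V → Bool
    adj-sym : ∀ u v → adj u v ≡ adj v u
    adj-irrefl : ∀ v → adj v v ≡ false
open Graph public

data Reach {V : Set} (G : Graph V) : V → V → Set where
  here : ∀ {v} → Reach G v v
  step : ∀ {u w v} → adj G u w ≡ true → Reach G w v → Reach G u v

Connected : {V : Set} → Graph V → Set
Connected G = ∀ u v → Reach G u v

record Aut {V : Set} (G : Graph V) : Set where
  field
    to       : V → V
    from     : V → V
    to-from  : ∀ v → to (from v) ≡ v
    from-to  : ∀ v → from (to v) ≡ v
    pres     : ∀ u v → adj G (to u) (to v) ≡ adj G u v
open Aut public

-- An edge colouring with d colours: a colour for each (unordered) pair;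
-- only the values on edges are relevant.
record EdgeColouring {V : Set} (G : Graph V) (d : ℕ) : Set where
  field
    col     : V → V → Fin d
    col-sym : ∀ u v → col u v ≡ col v u
open EdgeColouring public

Preserves : {V : Set} {G : Graph V} {d : ℕ} → Aut G → EdgeColouring G d → Set
Preserves {G = G} σ c =
  ∀ u v → adj G u v ≡ true → col c (to σ u) (to σ v) ≡ col c u v

IdentityOnEdges : {V : Set} {G : Graph V} → Aut G → Set
IdentityOnEdges {G = G} σ =
  ∀ u v → adj G u v ≡ true →
    (to σ u ≡ u × to σ v ≡ v) ⊎ (to σ u ≡ v × to σ v ≡ u)

Distinguishing : {V : Set} {G : Graph V} {d : ℕ} → EdgeColouring G d → Set
Distinguishing {G = G} c = ∀ (σ : Aut G) → Preserves σ c → IdentityOnEdges σ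

DistIndexIs : {V : Set} → Graph V → ℕ → Set
DistIndexIs G d =
  (∃ λ (c : EdgeColouring G d) → Distinguishing c) ×
  (∀ k → k < d → ¬ (∃ λ (c : EdgeColouring G k) → Distinguishing c))

-- Corona G ∘ H: vertices inj₁ i (copy of G) and inj₂ (i , a) (vertex a of the
-- i-th copy of H); i is joined to every vertex of the i-th copy of H.
eqb : {n : ℕ} → Fin n → Fin n → Bool
eqb i j = ⌊ i ≟ j ⌋

eqb-sym : {n : ℕ} (i j : Fin n) → eqb i j ≡ eqb j i
eqb-sym i j with i ≟ j | j ≟ i
... | yes _ | yes _ = refl
... | no _  | no _  = refl
... | yes p | no q  = ⊥-elim′ (q (sym p))
  where ⊥-elim′ : ∀ {A : Set} → Data.Empty.⊥ → A
        ⊥-elim′ ()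
... | no p  | yes q = ⊥-elim′ (p (sym q))
  where ⊥-elim′ : ∀ {A : Set} → Data.Empty.⊥ → A
        ⊥-elim′ ()

eqb-refl : {n : ℕ} (i : Fin n) → eqb i i ≡ true
eqb-refl i with i ≟ i
... | yes _ = refl
... | no p  = ⊥-elim′ (p refl)
  where ⊥-elim′ : ∀ {A : Set} → Data.Empty.⊥ → A
        ⊥-elim′ ()

CVert : ℕ → ℕ → Set
CVert n m = Fin n ⊎ (Fin n × Fin m)

cadj : {n m : ℕ} → Graph (Fin n) → Graph (Fin m) → CVert n m → CVert n m → Bool
cadj G H (inj₁ i) (inj₁ j) = adj G i j
cadj G H (inj₁ i) (inj₂ (j , b)) = eqb i j
cadj G H (inj₂ (i , a)) (inj₁ j) = eqb i j
cadj G H (inj₂ (i , a)) (inj₂ (j , b)) = eqb i j ∧ adj H a b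

corona : {n m : ℕ} → Graph (Fin n) → Graph (Fin m) → Graph (CVert n m)
corona {n} {m} G H = record { adj = cadj G H ; adj-sym = s ; adj-irrefl = ir }
  where
  s : ∀ u v → cadj G H u v ≡ cadj G H v u
  s (inj₁ i) (inj₁ j) = adj-sym G i j
  s (inj₁ i) (inj₂ (j , b)) = eqb-sym i j
  s (inj₂ (i , a)) (inj₁ j) = eqb-sym i j
  s (inj₂ (i , a)) (inj₂ (j , b)) =
    cong₂ _∧_ (eqb-sym i j) (adj-sym H a b)
  ir : ∀ v → cadj G H v v ≡ false
  ir (inj₁ i) = adj-irrefl G i
  ir (inj₂ (i , a)) rewrite eqb-refl i = adj-irrefl H a

-- Every automorphism of G ∘ H maps base vertices to base vertices: a vertex (i , a) of a copy of H
-- has a neighbour, i, adjacent to all its other neighbours, while a base vertex i does not: a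
-- G-neighbour j of i misses every vertex (i , a) of the i-th copy of H, and these miss j.  Hence an
-- automorphism of G ∘ H restricts to an automorphism of G, and, once the base is fixed, to an
-- automorphism of each copy of H.  D'(Γ) = 1 means every automorphism of Γ fixes every edge, and in
-- a connected graph on at least three vertices such an automorphism is the identity: a moved
-- vertex x has τ x as its only neighbour, so τ swaps the edge {x , τ x}, which is then a whole
-- component.  So G ∘ H is rigid and the one-colour colouring is distinguishing.
module Submission where

open import Defs
open import Data.Nat using (ℕ; _≥_; _<_; z≤n; s≤s)
open import Data.Fin using (Fin; zero; suc; _≟_)
open import Data.Bool using (Bool; true; _∧_)
open import Data.Bool.Properties using (∧-identityʳ)
open import Data.Sum using (_⊎_; inj₁; inj₂)
open import Data.Product using (_×_; _,_; ∃)
open import Function using (_∘_)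
open import Relation.Nullary using (¬_; yes; no; contradiction)
open import Relation.Binary.PropositionalEquality

AtLeastThree : Set → Set
AtLeastThree V = ∀ (x y : V) → ∃ λ w → w ≢ x × w ≢ y

Fin-atLeastThree : ∀ {k} → k ≥ 3 → AtLeastThree (Fin k)
Fin-atLeastThree (s≤s (s≤s (s≤s _))) x y with zero ≟ x | zero ≟ y
... | no 0≢x | no 0≢y = zero , 0≢x , 0≢y
... | yes refl | _ with suc zero ≟ y
...   | no 1≢y = suc zero , (λ ()) , 1≢y
...   | yes refl = suc (suc zero) , (λ ()) , (λ ())
Fin-atLeastThree (s≤s (s≤s (s≤s _))) x y | no _ | yes refl with suc zero ≟ x
...   | no 1≢x = suc zero , 1≢x , (λ ())
...   | yes refl = suc (suc zero) , (λ ()) , (λ ())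

Fin-element : ∀ {k} → k ≥ 3 → Fin k
Fin-element (s≤s _) = zero

Fin1-unique : (i j : Fin 1) → i ≡ j
Fin1-unique zero zero = refl

module _ {V : Set} {Γ : Graph V} where

  adj⇒≢ : ∀ {u v} → adj Γ u v ≡ true → u ≢ v
  adj⇒≢ {u} uv refl = contradiction (trans (sym uv) (adj-irrefl Γ u)) λ ()

  connected⇒neighbour : Connected Γ → AtLeastThree V → ∀ v → ∃ λ u → adj Γ v u ≡ true
  connected⇒neighbour connected atLeastThree v with atLeastThree v v
  ... | w , w≢v , _ with connected v w
  ...   | here = contradiction refl w≢v
  ...   | step vu _ = _ , vu

  adj-to : (σ : Aut Γ) → ∀ u x → adj Γ (to σ u) x ≡ adj Γ u (from σ x)
  adj-to σ u x = trans (cong (adj Γ (to σ u)) (sym (to-from σ x))) (pres σ u (from σ x))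

  inverse : Aut Γ → Aut Γ
  inverse σ = record
    { to = from σ ; from = to σ ; to-from = from-to σ ; from-to = to-from σ
    ; pres = λ u v → trans (sym (adj-to σ (from σ u) v)) (cong (λ t → adj Γ t v) (to-from σ u))
    }

  index-one⇒identityOnEdges : DistIndexIs Γ 1 → (τ : Aut Γ) → IdentityOnEdges τ
  index-one⇒identityOnEdges ((_ , distinguishing) , _) τ =
    distinguishing τ λ _ _ _ → Fin1-unique _ _

  rigid⇒index-one : V → (∀ (σ : Aut Γ) v → to σ v ≡ v) → DistIndexIs Γ 1
  rigid⇒index-one v rigid = (constant , λ σ _ x y _ → inj₁ (rigid σ x , rigid σ y)) , no-colouring
    where
    constant : EdgeColouring Γ 1
    constant = record { col = λ _ _ → zero ; col-sym = λ _ _ → refl }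
    no-colouring : ∀ k → k < 1 → ¬ ∃ λ (c : EdgeColouring Γ k) → Distinguishing c
    no-colouring 0 (s≤s z≤n) (c , _) with col c v v
    ... | ()

  fixed⇒fixed-by-inverse : (σ : Aut Γ) → ∀ {x} → to σ x ≡ x → from σ x ≡ x
  fixed⇒fixed-by-inverse σ {x} σx≡x = trans (cong (from σ) (sym σx≡x)) (from-to σ x)

  module _ {τ : Aut Γ} (fixesEdges : IdentityOnEdges τ) where

    moved⇒unique-neighbour : ∀ {x y} → to τ x ≢ x → adj Γ x y ≡ true → y ≡ to τ x
    moved⇒unique-neighbour τx≢x xy with fixesEdges _ _ xy
    ... | inj₁ (τx≡x , _) = contradiction τx≡x τx≢x
    ... | inj₂ (τx≡y , _) = sym τx≡y

    swapped-edge-is-component : ∀ {x z} → adj Γ x z ≡ true → to τ x ≡ z → to τ z ≡ x →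
      ∀ {a b} → Reach Γ a b → a ≡ x ⊎ a ≡ z → b ≡ x ⊎ b ≡ z
    swapped-edge-is-component xz τx≡z τz≡x here a∈ = a∈
    swapped-edge-is-component xz τx≡z τz≡x (step ac reach) (inj₁ refl) =
      swapped-edge-is-component xz τx≡z τz≡x reach
        (inj₂ (trans (moved⇒unique-neighbour (λ τx≡x → adj⇒≢ xz (trans (sym τx≡x) τx≡z)) ac) τx≡z))
    swapped-edge-is-component xz τx≡z τz≡x (step ac reach) (inj₂ refl) =
      swapped-edge-is-component xz τx≡z τz≡x reach
        (inj₁ (trans (moved⇒unique-neighbour (λ τz≡z → adj⇒≢ xz (trans (sym τz≡x) τz≡z)) ac) τz≡x))

    identityOnEdges⇒identity : Connected Γ → AtLeastThree V → ∀ x → to τ x ≡ x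
    identityOnEdges⇒identity connected atLeastThree x with connected⇒neighbour connected atLeastThree x
    ... | z , xz with fixesEdges x z xz
    ...   | inj₁ (τx≡x , _) = τx≡x
    ...   | inj₂ (τx≡z , τz≡x) with atLeastThree x z
    ...     | w , w≢x , w≢z
              with swapped-edge-is-component xz τx≡z τz≡x (connected x w) (inj₁ refl)
    ...       | inj₁ w≡x = contradiction w≡x w≢x
    ...       | inj₂ w≡z = contradiction w≡z w≢z

  index-one⇒rigid : Connected Γ → AtLeastThree V → DistIndexIs Γ 1 → ∀ (τ : Aut Γ) x → to τ x ≡ x
  index-one⇒rigid connected atLeastThree index τ =
    identityOnEdges⇒identity {τ = τ} (index-one⇒identityOnEdges index τ) connected atLeastThree

DominatedNeighbourhood : {V : Set} → Graph V → V → Set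
DominatedNeighbourhood Γ v =
  ∃ λ u → adj Γ v u ≡ true × (∀ x → adj Γ v x ≡ true → x ≢ u → adj Γ u x ≡ true)

module _ {V : Set} {Γ : Graph V} where

  dominated-to : (σ : Aut Γ) → ∀ {v} → DominatedNeighbourhood Γ v → DominatedNeighbourhood Γ (to σ v)
  dominated-to σ {v} (u , vu , dominates) = to σ u , trans (pres σ v u) vu , λ x vx x≢u →
    trans (adj-to σ u x)
      (dominates (from σ x) (trans (sym (adj-to σ v x)) vx)
        λ x′≡u → x≢u (trans (sym (to-from σ x)) (cong (to σ) x′≡u)))

  dominated-from : (σ : Aut Γ) → ∀ {v} → DominatedNeighbourhood Γ (to σ v) → DominatedNeighbourhood Γ v
  dominated-from σ {v} = subst (DominatedNeighbourhood Γ) (from-to σ v) ∘ dominated-to (inverse σ)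

module Restriction {V W : Set} {Γ : Graph V} {Δ : Graph W}
  (e : W → V) (r : V → W) (r∘e : ∀ w → r (e w) ≡ w)
  (adj-e : ∀ a b → adj Γ (e a) (e b) ≡ adj Δ a b) where

  Closed : Aut Γ → Set
  Closed σ = ∀ w → to σ (e w) ≡ e (r (to σ (e w)))

  private
    cancel : (σ : Aut Γ) → Closed (inverse σ) → ∀ w → r (to σ (e (r (from σ (e w))))) ≡ w
    cancel σ closed⁻¹ w = begin
      r (to σ (e (r (from σ (e w))))) ≡⟨ cong (r ∘ to σ) (sym (closed⁻¹ w)) ⟩
      r (to σ (from σ (e w)))         ≡⟨ cong r (to-from σ (e w)) ⟩
      r (e w)                         ≡⟨ r∘e w ⟩
      w                               ∎
      where open ≡-Reasoning

  restrict : (σ : Aut Γ) → Closed σ → Closed (inverse σ) → Aut Δ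
  restrict σ closed closed⁻¹ = record
    { to = r ∘ to σ ∘ e
    ; from = r ∘ from σ ∘ e
    ; to-from = cancel σ closed⁻¹
    -- Closed only inspects to, so Closed σ is Closed (inverse (inverse σ)) definitionally.
    ; from-to = cancel (inverse σ) closed
    ; pres = λ a b → begin
        adj Δ (r (to σ (e a))) (r (to σ (e b)))         ≡⟨ sym (adj-e _ _) ⟩
        adj Γ (e (r (to σ (e a)))) (e (r (to σ (e b)))) ≡⟨ sym (cong₂ (adj Γ) (closed a) (closed b)) ⟩
        adj Γ (to σ (e a)) (to σ (e b))                 ≡⟨ pres σ (e a) (e b) ⟩
        adj Γ (e a) (e b)                               ≡⟨ adj-e a b ⟩
        adj Δ a b                                       ∎
    }
    where open ≡-Reasoning

  rigid⇒image-fixed : (∀ (τ : Aut Δ) w → to τ w ≡ w) →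
    (σ : Aut Γ) → Closed σ → Closed (inverse σ) → ∀ w → to σ (e w) ≡ e w
  rigid⇒image-fixed rigid σ closed closed⁻¹ w =
    trans (closed w) (cong e (rigid (restrict σ closed closed⁻¹) w))

eqb-∧⇒≡ : ∀ {k} {i j : Fin k} {b : Bool} → eqb i j ∧ b ≡ true → i ≡ j
eqb-∧⇒≡ {i = i} {j} ij∧b with i ≟ j
... | yes i≡j = i≡j

eqb⇒≡ : ∀ {k} {i j : Fin k} → eqb i j ≡ true → i ≡ j
eqb⇒≡ ij = eqb-∧⇒≡ {b = true} (trans (∧-identityʳ _) ij)

module Corona {n m : ℕ} (G : Graph (Fin n)) (H : Graph (Fin m)) where

  C : Graph (CVert n m)
  C = corona G H

  base : CVert n m → Fin n
  base (inj₁ i) = i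
  base (inj₂ (i , _)) = i

  -- a₀ is a junk value on base vertices.
  fibre : Fin m → CVert n m → Fin m
  fibre a₀ (inj₁ _) = a₀
  fibre _ (inj₂ (_ , a)) = a

  copy-dominated : ∀ i a → DominatedNeighbourhood C (inj₂ (i , a))
  copy-dominated i a = inj₁ i , eqb-refl i , dominates
    where
    dominates : ∀ x → cadj G H (inj₂ (i , a)) x ≡ true → x ≢ inj₁ i → cadj G H (inj₁ i) x ≡ true
    dominates (inj₁ j) ij x≢i = contradiction (cong inj₁ (sym (eqb⇒≡ ij))) x≢i
    dominates (inj₂ (j , b)) ij∧ab _ = subst (λ k → eqb i k ≡ true) (eqb-∧⇒≡ ij∧ab) (eqb-refl i)

  undominated⇒base : ∀ {v} → ¬ DominatedNeighbourhood C v → v ≡ inj₁ (base v)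
  undominated⇒base {inj₁ i} _ = refl
  undominated⇒base {inj₂ (i , a)} undominated = contradiction (copy-dominated i a) undominated

  copy-adj : ∀ i a b → cadj G H (inj₂ (i , a)) (inj₂ (i , b)) ≡ adj H a b
  copy-adj i a b = cong (_∧ adj H a b) (eqb-refl i)

  module Base = Restriction {Γ = C} {Δ = G} inj₁ base (λ _ → refl) (λ _ _ → refl)

  module _ (a₀ : Fin m) (hasNeighbour : ∀ i → ∃ λ j → adj G i j ≡ true) where

    module Copy (i : Fin n) =
      Restriction {Γ = C} {Δ = H} (λ a → inj₂ (i , a)) (fibre a₀) (λ _ → refl) (copy-adj i)

    base-undominated : ∀ i → ¬ DominatedNeighbourhood C (inj₁ i)
    base-undominated i dominated with hasNeighbour i | dominated
    ... | j , ij | inj₁ k , ik , dominates =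
      adj⇒≢ {Γ = G} ik (sym (eqb⇒≡ (dominates (inj₂ (i , a₀)) (eqb-refl i) λ ())))
    ... | j , ij | inj₂ (k , b) , ik , dominates with eqb⇒≡ ik
    ...   | refl = adj⇒≢ {Γ = G} ij (eqb⇒≡ (dominates (inj₁ j) ij λ ()))

    dominated-neighbour⇒copy : ∀ {i v} → DominatedNeighbourhood C v → cadj G H (inj₁ i) v ≡ true →
      v ≡ inj₂ (i , fibre a₀ v)
    dominated-neighbour⇒copy {v = inj₁ j} dominated _ = contradiction dominated (base-undominated j)
    dominated-neighbour⇒copy {v = inj₂ (j , b)} _ ij with eqb⇒≡ ij
    ... | refl = refl

    base-closed : (ρ : Aut C) → Base.Closed ρ
    base-closed ρ i = undominated⇒base (base-undominated i ∘ dominated-from ρ)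

    copy-closed : (ρ : Aut C) → (∀ i → to ρ (inj₁ i) ≡ inj₁ i) → ∀ i → Copy.Closed i ρ
    copy-closed ρ fixesBase i a =
      dominated-neighbour⇒copy (dominated-to ρ (copy-dominated i a)) adjacent-to-base
      where
      open ≡-Reasoning
      ρa : CVert n m
      ρa = to ρ (inj₂ (i , a))
      adjacent-to-base : cadj G H (inj₁ i) ρa ≡ true
      adjacent-to-base = begin
        cadj G H (inj₁ i) ρa          ≡⟨ cong (λ t → cadj G H t ρa) (sym (fixesBase i)) ⟩
        cadj G H (to ρ (inj₁ i)) ρa   ≡⟨ pres ρ (inj₁ i) (inj₂ (i , a)) ⟩
        eqb i i                       ≡⟨ eqb-refl i ⟩
        true                          ∎

    corona-rigid : (∀ (τ : Aut G) i → to τ i ≡ i) → (∀ (τ : Aut H) a → to τ a ≡ a) →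
      ∀ (σ : Aut C) v → to σ v ≡ v
    corona-rigid rigidG rigidH σ = fixed
      where
      fixesBase : ∀ i → to σ (inj₁ i) ≡ inj₁ i
      fixesBase = Base.rigid⇒image-fixed rigidG σ (base-closed σ) (base-closed (inverse σ))
      fixed : ∀ v → to σ v ≡ v
      fixed (inj₁ i) = fixesBase i
      fixed (inj₂ (i , a)) = Copy.rigid⇒image-fixed i rigidH σ
        (copy-closed σ fixesBase i) (copy-closed (inverse σ) (fixed⇒fixed-by-inverse σ ∘ fixesBase) i) a

mainTheorem13 : (n m : ℕ) → n ≥ 3 → m ≥ 3 →
    (G : Graph (Fin n)) (H : Graph (Fin m)) →
    Connected G → Connected H →
    DistIndexIs G 1 → DistIndexIs H 1 →
    DistIndexIs (corona G H) 1
mainTheorem13 n m n≥3 m≥3 G H connectedG connectedH indexG indexH =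
  rigid⇒index-one (inj₁ (Fin-element n≥3))
    (corona-rigid (Fin-element m≥3) (connected⇒neighbour connectedG (Fin-atLeastThree n≥3))
      (index-one⇒rigid connectedG (Fin-atLeastThree n≥3) indexG)
      (index-one⇒rigid connectedH (Fin-atLeastThree m≥3) indexH))
  where open Corona G H
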